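{- Every finite tournament $T$ admits a colouring $c:V(T)\to\{1,2,3\}$ such that all but at most $205$ vertices $v$ of $T$ satisfy: the number of out-neighbours $w$ of $v$ with $c(w)=c(v)$ is at most $d^{+}(v)/2$, where $d^{+}(v)$ denotes the out-degree of $v$.
   Context: A tournament is a digraph in which for every pair of distinct vertices $u,v$ exactly one of the arcs $uv$, $vu$ is present. -}

module Defs where

open import Data.Nat using (ℕ; zero; suc; _+_; _*_; _≤_)
open import Data.Bool using (Bool; true; false; _∧_; not)
open import Data.Fin using (Fin; zero; suc)
open import Data.Fin.Properties using (_≟_)
open import Relation.Nullary.Decidable using (⌊_⌋)
open import Relation.Binary.PropositionalEquality using (_≡_; _≢_)

count : ∀ {n} → (Fin n → Bool) → ℕ
count {zero}  p = 0
count {suc n} p = b2n (p zero) + count (λ i → p (suc i))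
  where
  b2n : Bool → ℕ
  b2n true  = 1
  b2n false = 0

record Tournament (n : ℕ) : Set where
  field
    arc     : Fin n → Fin n → Bool
    irrefl  : ∀ u → arc u u ≡ false
    exactly : ∀ u v → u ≢ v → arc u v ≡ not (arc v u)

open Tournament public

outdeg : ∀ {n} → Tournament n → Fin n → ℕ
outdeg T v = count (λ w → arc T v w)

sameOut : ∀ {n} → Tournament n → (Fin n → Fin 3) → Fin n → ℕ
sameOut T c v = count (λ w → arc T v w ∧ ⌊ c w ≟ c v ⌋)

-- v is good iff sameOut ≤ d⁺(v)/2, i.e. 2 * sameOut ≤ d⁺(v) (exact, no rounding)
-- bad v = true iff v is NOT good
bad : ∀ {n} → Tournament n → (Fin n → Fin 3) → Fin n → Bool
bad T c v = not ⌊ Data.Nat._≤?_ (2 * sameOut T c v) (outdeg T v) ⌋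

module Submission where

-- Instead of a random colouring, sum over all 3^n colourings (∑ᶜ). For a vertex
-- v of out-degree d, let m be the number of out-neighbours sharing the colour of v. Given the
-- colour of v, the colours of its out-neighbours are independent, so ∑ᶜ 2^m = 3^n (4/3)^d;
-- Markov's inequality at threshold 2^⌈d/2⌉ then shows that v is bad for at most
-- 3^n / 2^⌊d/12⌋ colourings. Every tournament on s vertices has a vertex of out-degree at
-- least (s-1)/2, so deleting such vertices one at a time bounds ∑_v f(2 d⁺(v)) by ∑_{i<n} f(i)
-- for antitone f. Hence the pairs (colouring, bad vertex) number at most
-- 3^n ∑_i 2^-⌊i/24⌋ ≤ 48 · 3^n, and some colouring has at most 48 ≤ 205 bad vertices.

open import Defs
open import Data.Bool using (Bool; true; false; _∧_; not)
open import Data.Fin using (Fin; zero; suc; toℕ; punchIn)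
open import Data.Fin.Properties using (_≟_; any?; punchIn-injective)
open import Data.Nat
  using (ℕ; zero; suc; _+_; _*_; _∸_; _^_; _≤_; _<_; _≥_; z≤n; s≤s; _≤?_; NonZero; ⌊_/2⌋; ⌈_/2⌉; _/_)
open import Data.Nat.DivMod using (_%_; m≡m%n+[m/n]*n; m/n≡1+[m∸n]/n; m*n/m*o≡n/o; /-monoˡ-≤)
open import Data.Nat.Properties hiding (_≟_)
open import Data.Nat.Tactic.RingSolver using (solve-∀)
open import Data.Product using (∃; _,_; proj₁; proj₂)
open import Data.Sum using (inj₁; inj₂)
open import Data.Unit using (tt)
open import Data.Vec.Functional using (_∷_)
open import Function using (_∘_)
open import Relation.Binary.Core using (_Preserves_⟶_)
open import Relation.Binary.PropositionalEquality
open import Relation.Nullary using (Dec; yes; no; contradiction)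
open import Relation.Nullary.Decidable using (⌊_⌋; ⌊⌋-map′; toWitness)
open import Algebra.Properties.CommutativeSemigroup *-commutativeSemigroup
  using () renaming (interchange to *-interchange)
open import Algebra.Properties.Semiring.Sum +-*-semiring
  using (sum; sum-syntax; ∑-distrib-+; ∑-comm; sum-cong-≗; sum-remove; *-distribˡ-sum; *-distribʳ-sum)

𝟙 : Bool → ℕ
𝟙 true  = 1
𝟙 false = 0

count≡∑ : ∀ {n} (p : Fin n → Bool) → count p ≡ ∑[ i < n ] 𝟙 (p i)
count≡∑ {zero}  p = refl
count≡∑ {suc n} p with p zero
... | true  = cong suc (count≡∑ (λ i → p (suc i)))
... | false = count≡∑ (λ i → p (suc i))

count-suc : ∀ {n} (p : Fin (suc n) → Bool) → count p ≡ 𝟙 (p zero) + count (λ i → p (suc i))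
count-suc p = trans (count≡∑ p) (cong (𝟙 (p zero) +_) (sym (count≡∑ (λ i → p (suc i)))))

count-cong : ∀ {n} {p q : Fin n → Bool} → (∀ i → p i ≡ q i) → count p ≡ count q
count-cong {p = p} {q} p≗q = trans (count≡∑ p) (trans (sum-cong-≗ (cong 𝟙 ∘ p≗q)) (sym (count≡∑ q)))

∑-const : ∀ n a → ∑[ i < n ] a ≡ n * a
∑-const zero    a = refl
∑-const (suc n) a = cong (a +_) (∑-const n a)

∑-distrib-+₃ : ∀ {n} (f g h : Fin n → ℕ) → ∑[ i < n ] (f i + g i + h i) ≡ sum f + sum g + sum h
∑-distrib-+₃ f g h = trans (∑-distrib-+ (λ i → f i + g i) h) (cong (_+ sum h) (∑-distrib-+ f g))

∑-mono-≤ : ∀ {n} {f g : Fin n → ℕ} → (∀ i → f i ≤ g i) → sum f ≤ sum g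
∑-mono-≤ {zero}  f≤g = z≤n
∑-mono-≤ {suc n} f≤g = +-mono-≤ (f≤g zero) (∑-mono-≤ (λ i → f≤g (suc i)))

∑-mono-< : ∀ {n} {f g : Fin (suc n) → ℕ} → (∀ i → f i < g i) → sum f < sum g
∑-mono-< f<g = +-mono-<-≤ (f<g zero) (∑-mono-≤ (λ i → <⇒≤ (f<g (suc i))))

∑-point : ∀ {n} (i : Fin n) (g : Fin n → ℕ) → ∑[ j < n ] (𝟙 ⌊ j ≟ i ⌋ * g j) ≡ g i
∑-point {suc n} zero    g = trans (cong₂ _+_ (*-identityˡ (g zero)) (trans (∑-const n 0) (*-zeroʳ n))) (+-identityʳ _)
∑-point {suc n} (suc i) g =
  trans (sum-cong-≗ (λ j → cong (λ b → 𝟙 b * g (suc j)) (⌊⌋-map′ _ _ (j ≟ i)))) (∑-point i (λ j → g (suc j)))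

∑-𝟙[≟] : ∀ {n} (i : Fin n) → ∑[ j < n ] 𝟙 ⌊ j ≟ i ⌋ ≡ 1
∑-𝟙[≟] {n} i = trans (sum-cong-≗ {n} (λ j → sym (*-identityʳ _))) (∑-point i (λ _ → 1))

⌊≟⌋-sym : ∀ {n} (i j : Fin n) → ⌊ i ≟ j ⌋ ≡ ⌊ j ≟ i ⌋
⌊≟⌋-sym zero    zero    = refl
⌊≟⌋-sym zero    (suc j) = refl
⌊≟⌋-sym (suc i) zero    = refl
⌊≟⌋-sym (suc i) (suc j) =
  trans (⌊⌋-map′ _ _ (i ≟ j)) (trans (⌊≟⌋-sym i j) (sym (⌊⌋-map′ _ _ (j ≟ i))))

∃-≥-mean : ∀ {n} (g : Fin (suc n) → ℕ) t → suc n * t ≤ sum g → ∃ λ i → t ≤ g i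
∃-≥-mean {n} g t n*t≤∑g with any? (λ i → t ≤? g i)
... | yes found = found
... | no  none  = contradiction n*t≤∑g (<⇒≱ (begin-strict
  sum g                  <⟨ ∑-mono-< (λ i → ≰⇒> (λ t≤gi → none (i , t≤gi))) ⟩
  ∑[ i < suc n ] t       ≡⟨ ∑-const (suc n) t ⟩
  suc n * t              ∎))
  where open ≤-Reasoning

∃-≤-mean : ∀ {n} (g : Fin (suc n) → ℕ) → ∃ λ i → g i * suc n ≤ sum g
∃-≤-mean {n} g with any? (λ i → g i * suc n ≤? sum g)
... | yes found = found
... | no  none  = contradiction (begin-strict
  suc n * sum g          ≡⟨ ∑-const (suc n) (sum g) ⟨
  ∑[ i < suc n ] sum g   <⟨ ∑-mono-< (λ i → ≰⇒> (λ gi≤ → none (i , gi≤))) ⟩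
  ∑[ i < suc n ] (g i * suc n) ≡⟨ *-distribʳ-sum (suc n) g ⟨
  sum g * suc n          ∎) (<-irrefl (*-comm (suc n) (sum g)))
  where open ≤-Reasoning

∑-toℕ-snoc : ∀ n (a : ℕ → ℕ) → ∑[ i < suc n ] a (toℕ i) ≡ ∑[ i < n ] a (toℕ i) + a n
∑-toℕ-snoc zero    a = +-comm (a 0) 0
∑-toℕ-snoc (suc n) a =
  trans (cong (a 0 +_) (∑-toℕ-snoc n (λ i → a (suc i)))) (sym (+-assoc (a 0) _ _))

∑-toℕ-split : ∀ m n (a : ℕ → ℕ) →
  ∑[ i < m + n ] a (toℕ i) ≡ ∑[ i < m ] a (toℕ i) + ∑[ i < n ] a (m + toℕ i)
∑-toℕ-split zero    n a = refl
∑-toℕ-split (suc m) n a =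
  trans (cong (a 0 +_) (∑-toℕ-split m n (λ i → a (suc i)))) (sym (+-assoc (a 0) _ _))

∑-toℕ-mono-length : ∀ {m n} (a : ℕ → ℕ) → m ≤ n → ∑[ i < m ] a (toℕ i) ≤ ∑[ i < n ] a (toℕ i)
∑-toℕ-mono-length {m} {n} a m≤n = begin
  ∑[ i < m ] a (toℕ i)                                      ≤⟨ m≤m+n _ _ ⟩
  ∑[ i < m ] a (toℕ i) + ∑[ i < n ∸ m ] a (m + toℕ i)       ≡⟨ ∑-toℕ-split m (n ∸ m) a ⟨
  ∑[ i < m + (n ∸ m) ] a (toℕ i)                            ≡⟨ cong (λ l → ∑[ i < l ] a (toℕ i)) (m+[n∸m]≡n m≤n) ⟩
  ∑[ i < n ] a (toℕ i)                                      ∎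
  where open ≤-Reasoning

∑-halving : ∀ b .{{_ : NonZero b}} (a : ℕ → ℕ) → (∀ i → 2 * a (b + i) ≤ a i) →
  ∀ n → ∑[ i < n ] a (toℕ i) ≤ 2 * ∑[ i < b ] a (toℕ i)
∑-halving b a halves n = ≤-trans (∑-toℕ-mono-length a (m≤m*n n b)) (blocks n)
  where
  S = ∑[ i < b ] a (toℕ i)
  blocks : ∀ k → ∑[ i < k * b ] a (toℕ i) ≤ 2 * S
  blocks zero    = z≤n
  blocks (suc k) = begin
    ∑[ i < b + k * b ] a (toℕ i)                   ≡⟨ ∑-toℕ-split b (k * b) a ⟩
    S + ∑[ i < k * b ] a (b + toℕ i)               ≤⟨ +-monoʳ-≤ S (*-cancelˡ-≤ 2 (begin
      2 * ∑[ i < k * b ] a (b + toℕ i)               ≡⟨ *-distribˡ-sum {k * b} 2 (λ i → a (b + toℕ i)) ⟩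
      ∑[ i < k * b ] (2 * a (b + toℕ i))             ≤⟨ ∑-mono-≤ {k * b} (λ i → halves (toℕ i)) ⟩
      ∑[ i < k * b ] a (toℕ i)                       ≤⟨ blocks k ⟩
      2 * S                                          ∎)) ⟩
    S + S                                          ≡⟨ cong (S +_) (+-identityʳ S) ⟨
    2 * S                                          ∎
    where open ≤-Reasoning

infixl 7 _/2^_

_/2^_ : ℕ → ℕ → ℕ
n /2^ zero  = n
n /2^ suc q = ⌊ n /2^ q /2⌋

2*⌊n/2⌋≤n : ∀ n → 2 * ⌊ n /2⌋ ≤ n
2*⌊n/2⌋≤n n = begin
  ⌊ n /2⌋ + (⌊ n /2⌋ + 0)   ≡⟨ cong (⌊ n /2⌋ +_) (+-identityʳ _) ⟩
  ⌊ n /2⌋ + ⌊ n /2⌋         ≤⟨ +-monoʳ-≤ ⌊ n /2⌋ (⌊n/2⌋≤⌈n/2⌉ n) ⟩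
  ⌊ n /2⌋ + ⌈ n /2⌉         ≡⟨ ⌊n/2⌋+⌈n/2⌉≡n n ⟩
  n                         ∎
  where open ≤-Reasoning

⌊2*n/2⌋≡n : ∀ n → ⌊ 2 * n /2⌋ ≡ n
⌊2*n/2⌋≡n n = sym (trans (n≡⌊n+n/2⌋ n) (cong (λ k → ⌊ n + k /2⌋) (sym (+-identityʳ n))))

2*m≤n⇒m≤⌊n/2⌋ : ∀ {m n} → 2 * m ≤ n → m ≤ ⌊ n /2⌋
2*m≤n⇒m≤⌊n/2⌋ {m} 2m≤n = subst (_≤ _) (⌊2*n/2⌋≡n m) (⌊n/2⌋-mono 2m≤n)

n<2*m⇒⌈n/2⌉≤m : ∀ {m n} → n < 2 * m → ⌈ n /2⌉ ≤ m
n<2*m⇒⌈n/2⌉≤m {m} n<2m = subst (_ ≤_) (⌊2*n/2⌋≡n m) (⌊n/2⌋-mono n<2m)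

m*2^q≤n⇒m≤n/2^q : ∀ {m n} q → m * 2 ^ q ≤ n → m ≤ n /2^ q
m*2^q≤n⇒m≤n/2^q {m} zero    m≤n = subst (_≤ _) (*-identityʳ m) m≤n
m*2^q≤n⇒m≤n/2^q {m} {n} (suc q) le = 2*m≤n⇒m≤⌊n/2⌋ (m*2^q≤n⇒m≤n/2^q q (subst (_≤ n) (m*[2*k]≡2*m*k m (2 ^ q)) le))
  where
  m*[2*k]≡2*m*k : ∀ m k → m * (2 * k) ≡ 2 * m * k
  m*[2*k]≡2*m*k = solve-∀

/2^-antitone : ∀ n → (n /2^_) Preserves _≤_ ⟶ _≥_
/2^-antitone n {y = zero}  z≤n = ≤-refl
/2^-antitone n {y = suc q} p≤1+q with m≤n⇒m<n∨m≡n p≤1+q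
... | inj₁ (s≤s p≤q) = ≤-trans (⌊n/2⌋≤n (n /2^ q)) (/2^-antitone n p≤q)
... | inj₂ refl      = ≤-refl

2*n/2^[1+q]≤n/2^q : ∀ n q → 2 * (n /2^ suc q) ≤ n /2^ q
2*n/2^[1+q]≤n/2^q n q = 2*⌊n/2⌋≤n (n /2^ q)

∑-m/2^[i/b]≤2*b*m : ∀ b .{{_ : NonZero b}} m n → ∑[ i < n ] (m /2^ (toℕ i / b)) ≤ 2 * (b * m)
∑-m/2^[i/b]≤2*b*m b m n = begin
  ∑[ i < n ] a (toℕ i)        ≤⟨ ∑-halving b a halves n ⟩
  2 * ∑[ i < b ] a (toℕ i)    ≤⟨ *-monoʳ-≤ 2 (∑-mono-≤ {b} (λ i → /2^-antitone m (z≤n {toℕ i / b}))) ⟩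
  2 * ∑[ i < b ] m            ≡⟨ cong (2 *_) (∑-const b m) ⟩
  2 * (b * m)                 ∎
  where
  open ≤-Reasoning
  a : ℕ → ℕ
  a i = m /2^ (i / b)
  [b+i]/b≡1+i/b : ∀ i → (b + i) / b ≡ suc (i / b)
  [b+i]/b≡1+i/b i = trans (m/n≡1+[m∸n]/n (m≤m+n b i)) (cong (λ k → suc (k / b)) (m+n∸m≡n b i))
  halves : ∀ i → 2 * a (b + i) ≤ a i
  halves i rewrite [b+i]/b≡1+i/b i = 2*n/2^[1+q]≤n/2^q m (i / b)

arc-trichotomy : ∀ {n} (T : Tournament n) u v → 𝟙 (arc T u v) + 𝟙 (arc T v u) + 𝟙 ⌊ v ≟ u ⌋ ≡ 1
arc-trichotomy T u v with v ≟ u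
... | yes refl rewrite irrefl T u = refl
... | no v≢u rewrite exactly T u v (v≢u ∘ sym) with arc T v u
...   | true  = refl
...   | false = refl

2*∑outdeg+n≡n*n : ∀ {n} (T : Tournament n) → 2 * ∑[ u < n ] outdeg T u + n ≡ n * n
2*∑outdeg+n≡n*n {n} T = begin
  2 * D + n                                    ≡⟨ cong (_+ n) (cong (D +_) (+-identityʳ D)) ⟩
  D + D + n                                    ≡⟨ cong₂ _+_ (cong₂ _+_ D≡∑∑out D≡∑∑in) n≡∑∑loop ⟩
  ∑∑ out + ∑∑ in′ + ∑∑ loop                    ≡⟨ ∑-distrib-+₃ (sum ∘ out) (sum ∘ in′) (sum ∘ loop) ⟨
  ∑[ u < n ] (sum (out u) + sum (in′ u) + sum (loop u))
                                               ≡⟨ sum-cong-≗ {n} (λ u → ∑-distrib-+₃ (out u) (in′ u) (loop u)) ⟨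
  ∑∑ (λ u v → out u v + in′ u v + loop u v)    ≡⟨ sum-cong-≗ {n} (λ u → sum-cong-≗ {n} (arc-trichotomy T u)) ⟩
  ∑∑ (λ _ _ → 1)                               ≡⟨ sum-cong-≗ {n} (λ _ → ∑1≡n) ⟩
  ∑[ u < n ] n                                 ≡⟨ ∑-const n n ⟩
  n * n                                        ∎
  where
  open ≡-Reasoning
  D = ∑[ u < n ] outdeg T u
  ∑∑ : (Fin n → Fin n → ℕ) → ℕ
  ∑∑ g = ∑[ u < n ] ∑[ v < n ] g u v
  out in′ loop : Fin n → Fin n → ℕ
  out  u v = 𝟙 (arc T u v)
  in′  u v = 𝟙 (arc T v u)
  loop u v = 𝟙 ⌊ v ≟ u ⌋
  ∑1≡n : ∑[ v < n ] 1 ≡ n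
  ∑1≡n = trans (∑-const n 1) (*-identityʳ n)
  D≡∑∑out : D ≡ ∑∑ out
  D≡∑∑out = sum-cong-≗ {n} (λ u → count≡∑ (arc T u))
  D≡∑∑in : D ≡ ∑∑ in′
  D≡∑∑in = trans D≡∑∑out (∑-comm {n} {n} out)
  n≡∑∑loop : n ≡ ∑∑ loop
  n≡∑∑loop = sym (trans (sum-cong-≗ {n} ∑-𝟙[≟]) ∑1≡n)

∃-n≤2*outdeg : ∀ {n} (T : Tournament (suc n)) → ∃ λ z → n ≤ 2 * outdeg T z
∃-n≤2*outdeg {n} T with ∃-≥-mean (λ v → suc (2 * outdeg T v)) (suc n) (≤-reflexive mean)
  where
  mean : suc n * suc n ≡ ∑[ v < suc n ] suc (2 * outdeg T v)
  mean = begin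
    suc n * suc n                                          ≡⟨ 2*∑outdeg+n≡n*n T ⟨
    2 * ∑[ v < suc n ] outdeg T v + suc n                  ≡⟨ +-comm _ (suc n) ⟩
    suc n + 2 * ∑[ v < suc n ] outdeg T v                  ≡⟨ cong₂ _+_ (sym ∑1≡1+n) (*-distribˡ-sum {suc n} 2 (outdeg T)) ⟩
    ∑[ v < suc n ] 1 + ∑[ v < suc n ] (2 * outdeg T v)     ≡⟨ ∑-distrib-+ {suc n} (λ _ → 1) (λ v → 2 * outdeg T v) ⟨
    ∑[ v < suc n ] suc (2 * outdeg T v)                    ∎
    where
    open ≡-Reasoning
    ∑1≡1+n : ∑[ v < suc n ] 1 ≡ suc n
    ∑1≡1+n = trans (∑-const (suc n) 1) (*-identityʳ (suc n))
... | z , s≤s n≤2d = z , n≤2d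

removeVertex : ∀ {n} → Tournament (suc n) → Fin (suc n) → Tournament n
arc     (removeVertex T z) u v     = arc T (punchIn z u) (punchIn z v)
irrefl  (removeVertex T z) u       = irrefl T (punchIn z u)
exactly (removeVertex T z) u v u≢v = exactly T (punchIn z u) (punchIn z v) (u≢v ∘ punchIn-injective z u v)

outdeg-removeVertex : ∀ {n} (T : Tournament (suc n)) z v → outdeg (removeVertex T z) v ≤ outdeg T (punchIn z v)
outdeg-removeVertex {n} T z v = begin
  outdeg (removeVertex T z) v                                  ≡⟨ count≡∑ (arc (removeVertex T z) v) ⟩
  ∑[ w < n ] 𝟙 (arc T (punchIn z v) (punchIn z w))             ≤⟨ m≤n+m _ _ ⟩
  𝟙 (arc T (punchIn z v) z) + ∑[ w < n ] 𝟙 (arc T (punchIn z v) (punchIn z w))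
                                                               ≡⟨ sum-remove {i = z} (λ w → 𝟙 (arc T (punchIn z v) w)) ⟨
  ∑[ w < suc n ] 𝟙 (arc T (punchIn z v) w)                    ≡⟨ count≡∑ (arc T (punchIn z v)) ⟨
  outdeg T (punchIn z v)                                       ∎
  where open ≤-Reasoning

∑-antitone[2*outdeg]≤ : ∀ {n} (T : Tournament n) (f : ℕ → ℕ) → f Preserves _≤_ ⟶ _≥_ →
  ∑[ v < n ] f (2 * outdeg T v) ≤ ∑[ i < n ] f (toℕ i)
∑-antitone[2*outdeg]≤ {zero}  T f f-anti = z≤n
∑-antitone[2*outdeg]≤ {suc n} T f f-anti with ∃-n≤2*outdeg T
... | z , n≤2dz = begin
  ∑[ v < suc n ] f (2 * outdeg T v)                                  ≡⟨ sum-remove {i = z} (λ v → f (2 * outdeg T v)) ⟩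
  f (2 * outdeg T z) + ∑[ v < n ] f (2 * outdeg T (punchIn z v))     ≤⟨ +-mono-≤ (f-anti n≤2dz) (∑-mono-≤ {n} removal-mono) ⟩
  f n + ∑[ v < n ] f (2 * outdeg T′ v)                               ≤⟨ +-monoʳ-≤ (f n) (∑-antitone[2*outdeg]≤ T′ f f-anti) ⟩
  f n + ∑[ i < n ] f (toℕ i)                                         ≡⟨ trans (+-comm (f n) _) (sym (∑-toℕ-snoc n f)) ⟩
  ∑[ i < suc n ] f (toℕ i)                                           ∎
  where
  open ≤-Reasoning
  T′ = removeVertex T z
  removal-mono : ∀ v → f (2 * outdeg T (punchIn z v)) ≤ f (2 * outdeg T′ v)
  removal-mono v = f-anti (*-monoʳ-≤ 2 (outdeg-removeVertex T z v))

∑ᶜ : ∀ {k} n → ((Fin n → Fin k) → ℕ) → ℕ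
∑ᶜ         zero    F = F (λ ())
∑ᶜ {k = k} (suc n) F = ∑[ y < k ] ∑ᶜ n (λ c → F (y ∷ c))

∑ᶜ-cong : ∀ {k} n {F G : (Fin n → Fin k) → ℕ} → (∀ c → F c ≡ G c) → ∑ᶜ n F ≡ ∑ᶜ n G
∑ᶜ-cong zero    F≗G = F≗G _
∑ᶜ-cong (suc n) F≗G = sum-cong-≗ (λ y → ∑ᶜ-cong n (λ c → F≗G (y ∷ c)))

∑ᶜ-mono-≤ : ∀ {k} n {F G : (Fin n → Fin k) → ℕ} → (∀ c → F c ≤ G c) → ∑ᶜ n F ≤ ∑ᶜ n G
∑ᶜ-mono-≤ zero    F≤G = F≤G _
∑ᶜ-mono-≤ (suc n) F≤G = ∑-mono-≤ (λ y → ∑ᶜ-mono-≤ n (λ c → F≤G (y ∷ c)))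

*-distribˡ-∑ᶜ : ∀ {k} n a (F : (Fin n → Fin k) → ℕ) → a * ∑ᶜ n F ≡ ∑ᶜ n (λ c → a * F c)
*-distribˡ-∑ᶜ zero    a F = refl
*-distribˡ-∑ᶜ {k} (suc n) a F =
  trans (*-distribˡ-sum a (λ y → ∑ᶜ n (λ c → F (y ∷ c)))) (sum-cong-≗ {k} (λ y → *-distribˡ-∑ᶜ n a (λ c → F (y ∷ c))))

∑ᶜ-comm : ∀ {k} n {m} (F : (Fin n → Fin k) → Fin m → ℕ) →
  ∑ᶜ n (λ c → ∑[ i < m ] F c i) ≡ ∑[ i < m ] ∑ᶜ n (λ c → F c i)
∑ᶜ-comm zero        F = refl
∑ᶜ-comm {k} (suc n) F =
  trans (sum-cong-≗ {k} (λ y → ∑ᶜ-comm n (λ c → F (y ∷ c)))) (∑-comm (λ y i → ∑ᶜ n (λ c → F (y ∷ c) i)))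

∃-≤-∑ᶜ-mean : ∀ {k} n (F : (Fin n → Fin (suc k)) → ℕ) → ∃ λ c → F c * suc k ^ n ≤ ∑ᶜ n F
∃-≤-∑ᶜ-mean zero F = (λ ()) , ≤-reflexive (*-identityʳ _)
∃-≤-∑ᶜ-mean {k} (suc n) F = below-mean (∃-≤-mean (λ y → F (y ∷ best y)))
  where
  best : Fin (suc k) → (Fin n → Fin (suc k))
  best y = proj₁ (∃-≤-∑ᶜ-mean n (λ c → F (y ∷ c)))
  below-mean : (∃ λ y → F (y ∷ best y) * suc k ≤ ∑[ y′ < suc k ] F (y′ ∷ best y′)) →
               ∃ λ c → F c * suc k ^ suc n ≤ ∑ᶜ (suc n) F
  below-mean (y , y-below) = y ∷ best y , (begin
    F (y ∷ best y) * (suc k * suc k ^ n)                     ≡⟨ *-assoc (F (y ∷ best y)) (suc k) (suc k ^ n) ⟨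
    F (y ∷ best y) * suc k * suc k ^ n                       ≤⟨ *-monoˡ-≤ (suc k ^ n) y-below ⟩
    ∑[ y′ < suc k ] F (y′ ∷ best y′) * suc k ^ n             ≡⟨ *-distribʳ-sum (suc k ^ n) (λ y′ → F (y′ ∷ best y′)) ⟩
    ∑[ y′ < suc k ] (F (y′ ∷ best y′) * suc k ^ n)           ≤⟨ ∑-mono-≤ (λ y′ → proj₂ (∃-≤-∑ᶜ-mean n (λ c → F (y′ ∷ c)))) ⟩
    ∑ᶜ (suc n) F                                             ∎)
    where open ≤-Reasoning

IndependentOf : ∀ {k n} → Fin n → ((Fin n → Fin k) → ℕ) → Set
IndependentOf v G = ∀ c c′ → (∀ w → w ≢ v → c w ≡ c′ w) → G c ≡ G c′

k*∑ᶜ-fixing-colour : ∀ {k} n v x (G : (Fin n → Fin k) → ℕ) → IndependentOf v G →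
  k * ∑ᶜ n (λ c → 𝟙 ⌊ c v ≟ x ⌋ * G c) ≡ ∑ᶜ n G
k*∑ᶜ-fixing-colour {k} (suc n) zero x G G-indep = begin
  k * ∑[ y < k ] ∑ᶜ n (λ c → 𝟙 ⌊ y ≟ x ⌋ * G (y ∷ c))
    ≡⟨ cong (k *_) (sum-cong-≗ {k} (λ y → *-distribˡ-∑ᶜ n (𝟙 ⌊ y ≟ x ⌋) (G′ y))) ⟨
  k * ∑[ y < k ] (𝟙 ⌊ y ≟ x ⌋ * ∑ᶜ n (G′ y))
    ≡⟨ cong (k *_) (∑-point x (λ y → ∑ᶜ n (G′ y))) ⟩
  k * ∑ᶜ n (G′ x)
    ≡⟨ ∑-const k _ ⟨
  ∑[ y < k ] ∑ᶜ n (G′ x)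
    ≡⟨ sum-cong-≗ {k} (λ y → ∑ᶜ-cong n (λ c → G-indep _ _ (agree c))) ⟩
  ∑[ y < k ] ∑ᶜ n (G′ y)
    ∎
  where
  open ≡-Reasoning
  G′ : Fin k → (Fin n → Fin k) → ℕ
  G′ y c = G (y ∷ c)
  agree : ∀ {y} c w → w ≢ zero → (x ∷ c) w ≡ (y ∷ c) w
  agree c zero    w≢0 = contradiction refl w≢0
  agree c (suc w) _   = refl
k*∑ᶜ-fixing-colour {k} (suc n) (suc v) x G G-indep = begin
  k * ∑[ y < k ] ∑ᶜ n (λ c → 𝟙 ⌊ c v ≟ x ⌋ * G′ y c)
    ≡⟨ *-distribˡ-sum {k} k (λ y → ∑ᶜ n (λ c → 𝟙 ⌊ c v ≟ x ⌋ * G′ y c)) ⟩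
  ∑[ y < k ] (k * ∑ᶜ n (λ c → 𝟙 ⌊ c v ≟ x ⌋ * G′ y c))
    ≡⟨ sum-cong-≗ {k} (λ y → k*∑ᶜ-fixing-colour n v x (G′ y) (G′-indep y)) ⟩
  ∑[ y < k ] ∑ᶜ n (G′ y)
    ∎
  where
  open ≡-Reasoning
  G′ : Fin k → (Fin n → Fin k) → ℕ
  G′ y c = G (y ∷ c)
  agree-∷ : ∀ {y c c′} → (∀ w → w ≢ v → c w ≡ c′ w) → ∀ w → w ≢ suc v → (y ∷ c) w ≡ (y ∷ c′) w
  agree-∷ agree zero    _        = refl
  agree-∷ agree (suc w) w≢1+v    = agree w (w≢1+v ∘ cong suc)
  G′-indep : ∀ y → IndependentOf v (G′ y)
  G′-indep y c c′ agree = G-indep _ _ (agree-∷ agree)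

hits : ∀ {k n} → (Fin n → Bool) → Fin k → (Fin n → Fin k) → ℕ
hits b x c = count (λ w → b w ∧ ⌊ c w ≟ x ⌋)

hits-∷ : ∀ {k n} (b : Fin (suc n) → Bool) (x y : Fin k) c →
  hits b x (y ∷ c) ≡ 𝟙 (b zero ∧ ⌊ y ≟ x ⌋) + hits (λ i → b (suc i)) x c
hits-∷ b x y c = count-suc (λ w → b w ∧ ⌊ (y ∷ c) w ≟ x ⌋)

∑-2^𝟙[β∧y≟x] : ∀ {k} β (x : Fin k) → ∑[ y < k ] (2 ^ 𝟙 (β ∧ ⌊ y ≟ x ⌋)) ≡ k + 𝟙 β
∑-2^𝟙[β∧y≟x] {k} false x = trans (∑-const k 1) (trans (*-identityʳ k) (sym (+-identityʳ k)))
∑-2^𝟙[β∧y≟x] {k} true  x = begin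
  ∑[ y < k ] (2 ^ 𝟙 ⌊ y ≟ x ⌋)            ≡⟨ sum-cong-≗ {k} (λ y → 2^𝟙≡1+𝟙 ⌊ y ≟ x ⌋) ⟩
  ∑[ y < k ] (1 + 𝟙 ⌊ y ≟ x ⌋)            ≡⟨ ∑-distrib-+ {k} (λ _ → 1) (λ y → 𝟙 ⌊ y ≟ x ⌋) ⟩
  ∑[ y < k ] 1 + ∑[ y < k ] 𝟙 ⌊ y ≟ x ⌋   ≡⟨ cong₂ _+_ (trans (∑-const k 1) (*-identityʳ k)) (∑-𝟙[≟] x) ⟩
  k + 1                                    ∎
  where
  open ≡-Reasoning
  2^𝟙≡1+𝟙 : ∀ b → 2 ^ 𝟙 b ≡ 1 + 𝟙 b
  2^𝟙≡1+𝟙 true  = refl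
  2^𝟙≡1+𝟙 false = refl

∑ᶜ-2^hits : ∀ {k} n (b : Fin n → Bool) (x : Fin k) →
  ∑ᶜ n (λ c → 2 ^ hits b x c) * k ^ count b ≡ k ^ n * suc k ^ count b
∑ᶜ-2^hits zero b x = refl
∑ᶜ-2^hits {k} (suc n) b x = begin
  ∑ᶜ (suc n) (λ c → 2 ^ hits b x c) * k ^ count b
    ≡⟨ cong₂ _*_ first-colour (cong (k ^_) (count-suc b)) ⟩
  (k + 𝟙 β) * M * k ^ (𝟙 β + count b′)
    ≡⟨ cong ((k + 𝟙 β) * M *_) (^-distribˡ-+-* k (𝟙 β) (count b′)) ⟩
  (k + 𝟙 β) * M * (k ^ 𝟙 β * k ^ count b′)
    ≡⟨ *-interchange (k + 𝟙 β) M (k ^ 𝟙 β) (k ^ count b′) ⟩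
  (k + 𝟙 β) * k ^ 𝟙 β * (M * k ^ count b′)
    ≡⟨ cong₂ _*_ (factor β) (∑ᶜ-2^hits n b′ x) ⟩
  k * suc k ^ 𝟙 β * (k ^ n * suc k ^ count b′)
    ≡⟨ *-interchange k (suc k ^ 𝟙 β) (k ^ n) (suc k ^ count b′) ⟩
  k ^ suc n * (suc k ^ 𝟙 β * suc k ^ count b′)
    ≡⟨ cong (k ^ suc n *_) (trans (cong (suc k ^_) (count-suc b)) (^-distribˡ-+-* (suc k) (𝟙 β) (count b′))) ⟨
  k ^ suc n * suc k ^ count b
    ∎
  where
  open ≡-Reasoning
  β  = b zero
  b′ = λ i → b (suc i)
  M  = ∑ᶜ n (λ c → 2 ^ hits b′ x c)
  2^hits-∷ : ∀ y c → 2 ^ hits b x (y ∷ c) ≡ 2 ^ 𝟙 (β ∧ ⌊ y ≟ x ⌋) * 2 ^ hits b′ x c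
  2^hits-∷ y c = trans (cong (2 ^_) (hits-∷ b x y c)) (^-distribˡ-+-* 2 (𝟙 (β ∧ ⌊ y ≟ x ⌋)) (hits b′ x c))
  first-colour : ∑ᶜ (suc n) (λ c → 2 ^ hits b x c) ≡ (k + 𝟙 β) * M
  first-colour = begin
    ∑[ y < k ] ∑ᶜ n (λ c → 2 ^ hits b x (y ∷ c))
      ≡⟨ sum-cong-≗ {k} (λ y → ∑ᶜ-cong n (2^hits-∷ y)) ⟩
    ∑[ y < k ] ∑ᶜ n (λ c → 2 ^ 𝟙 (β ∧ ⌊ y ≟ x ⌋) * 2 ^ hits b′ x c)
      ≡⟨ sum-cong-≗ {k} (λ y → *-distribˡ-∑ᶜ n (2 ^ 𝟙 (β ∧ ⌊ y ≟ x ⌋)) _) ⟨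
    ∑[ y < k ] (2 ^ 𝟙 (β ∧ ⌊ y ≟ x ⌋) * M)
      ≡⟨ *-distribʳ-sum M (λ y → 2 ^ 𝟙 (β ∧ ⌊ y ≟ x ⌋)) ⟨
    ∑[ y < k ] (2 ^ 𝟙 (β ∧ ⌊ y ≟ x ⌋)) * M
      ≡⟨ cong (_* M) (∑-2^𝟙[β∧y≟x] β x) ⟩
    (k + 𝟙 β) * M
      ∎
  factor : ∀ β → (k + 𝟙 β) * k ^ 𝟙 β ≡ k * suc k ^ 𝟙 β
  factor false = cong (_* 1) (+-identityʳ k)
  factor true  = [k+1]*[k*1]≡k*[[1+k]*1] k
    where
    [k+1]*[k*1]≡k*[[1+k]*1] : ∀ k → (k + 1) * (k * 1) ≡ k * ((1 + k) * 1)
    [k+1]*[k*1]≡k*[[1+k]*1] = solve-∀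

hits-independent : ∀ {k n} (b : Fin n → Bool) v (x : Fin k) → b v ≡ false →
  IndependentOf v (λ c → 2 ^ hits b x c)
hits-independent b v x bv c c′ agree = cong (2 ^_) (count-cong same)
  where
  same : ∀ w → (b w ∧ ⌊ c w ≟ x ⌋) ≡ (b w ∧ ⌊ c′ w ≟ x ⌋)
  same w with w ≟ v
  ... | yes refl rewrite bv       = refl
  ... | no w≢v   rewrite agree w w≢v = refl

∑ᶜ-2^hits-own-colour : ∀ {k} .{{_ : NonZero k}} n (b : Fin n → Bool) v → b v ≡ false →
  ∑ᶜ n (λ c → 2 ^ hits b (c v) c) * k ^ count b ≡ k ^ n * suc k ^ count b
∑ᶜ-2^hits-own-colour {k} n b v bv = *-cancelˡ-≡ _ _ k (begin
  k * (∑ᶜ n (λ c → 2 ^ hits b (c v) c) * K)          ≡⟨ cong (λ s → k * (s * K)) by-own-colour ⟩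
  k * (∑[ x < k ] A x * K)                            ≡⟨ cong (k *_) (*-distribʳ-sum K A) ⟩
  k * ∑[ x < k ] (A x * K)                            ≡⟨ *-distribˡ-sum k (λ x → A x * K) ⟩
  ∑[ x < k ] (k * (A x * K))                          ≡⟨ sum-cong-≗ {k} (λ x → sym (*-assoc k (A x) K)) ⟩
  ∑[ x < k ] (k * A x * K)                            ≡⟨ sum-cong-≗ {k} (λ x → cong (_* K) (fix-colour x)) ⟩
  ∑[ x < k ] (∑ᶜ n (λ c → 2 ^ hits b x c) * K)        ≡⟨ sum-cong-≗ {k} (∑ᶜ-2^hits n b) ⟩
  ∑[ x < k ] (k ^ n * suc k ^ count b)                ≡⟨ ∑-const k _ ⟩
  k * (k ^ n * suc k ^ count b)                       ∎)
  where
  open ≡-Reasoning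
  K = k ^ count b
  A : Fin k → ℕ
  A x = ∑ᶜ n (λ c → 𝟙 ⌊ c v ≟ x ⌋ * 2 ^ hits b x c)
  fix-colour : ∀ x → k * A x ≡ ∑ᶜ n (λ c → 2 ^ hits b x c)
  fix-colour x = k*∑ᶜ-fixing-colour n v x (λ c → 2 ^ hits b x c) (hits-independent b v x bv)
  by-own-colour : ∑ᶜ n (λ c → 2 ^ hits b (c v) c) ≡ ∑[ x < k ] A x
  by-own-colour = trans (∑ᶜ-cong n (λ c → sym (trans
      (sum-cong-≗ {k} (λ x → cong (λ t → 𝟙 t * 2 ^ hits b x c) (⌊≟⌋-sym (c v) x)))
      (∑-point (c v) (λ x → 2 ^ hits b x c)))))
    (∑ᶜ-comm n (λ c x → 𝟙 ⌊ c v ≟ x ⌋ * 2 ^ hits b x c))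

4^e≤2^⌈e/2⌉*3^e : ∀ e → 4 ^ e ≤ 2 ^ ⌈ e /2⌉ * 3 ^ e
4^e≤2^⌈e/2⌉*3^e zero          = ≤-refl
4^e≤2^⌈e/2⌉*3^e (suc zero)    = s≤s (s≤s (s≤s (s≤s z≤n)))
4^e≤2^⌈e/2⌉*3^e (suc (suc e)) = begin
  4 * (4 * 4 ^ e)                            ≡⟨ *-assoc 4 4 (4 ^ e) ⟨
  16 * 4 ^ e                                 ≤⟨ *-mono-≤ (m≤m+n 16 2) (4^e≤2^⌈e/2⌉*3^e e) ⟩
  18 * (2 ^ ⌈ e /2⌉ * 3 ^ e)                 ≡⟨ 18*[p*q]≡2*p*[3*[3*q]] (2 ^ ⌈ e /2⌉) (3 ^ e) ⟩
  2 * 2 ^ ⌈ e /2⌉ * (3 * (3 * 3 ^ e))        ∎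
  where
  open ≤-Reasoning
  18*[p*q]≡2*p*[3*[3*q]] : ∀ p q → 18 * (p * q) ≡ 2 * p * (3 * (3 * q))
  18*[p*q]≡2*p*[3*[3*q]] = solve-∀

-- (4/3)^12 < 2^5: twelve more out-neighbours buy six more factors of 2 in Markov's
-- inequality but lose at most five to the moment, so the bound halves.
2*4^12≤2^6*3^12 : 2 * 4 ^ 12 ≤ 2 ^ 6 * 3 ^ 12
2*4^12≤2^6*3^12 = toWitness {a? = 2 * 4 ^ 12 ≤? 2 ^ 6 * 3 ^ 12} tt

2^q*4^x≤⇒2^[1+q]*4^[12+x]≤ : ∀ q x → 2 ^ q * 4 ^ x ≤ 2 ^ ⌈ x /2⌉ * 3 ^ x →
  2 ^ suc q * 4 ^ (12 + x) ≤ 2 ^ (6 + ⌈ x /2⌉) * 3 ^ (12 + x)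
2^q*4^x≤⇒2^[1+q]*4^[12+x]≤ q x ih = begin
  2 * 2 ^ q * 4 ^ (12 + x)                        ≡⟨ cong (2 * 2 ^ q *_) (^-distribˡ-+-* 4 12 x) ⟩
  2 * 2 ^ q * (4 ^ 12 * 4 ^ x)                    ≡⟨ *-interchange 2 (2 ^ q) (4 ^ 12) (4 ^ x) ⟩
  2 * 4 ^ 12 * (2 ^ q * 4 ^ x)                    ≤⟨ *-mono-≤ 2*4^12≤2^6*3^12 ih ⟩
  2 ^ 6 * 3 ^ 12 * (2 ^ ⌈ x /2⌉ * 3 ^ x)          ≡⟨ *-interchange (2 ^ 6) (3 ^ 12) (2 ^ ⌈ x /2⌉) (3 ^ x) ⟩
  2 ^ 6 * 2 ^ ⌈ x /2⌉ * (3 ^ 12 * 3 ^ x)          ≡⟨ cong₂ _*_ (^-distribˡ-+-* 2 6 ⌈ x /2⌉) (^-distribˡ-+-* 3 12 x) ⟨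
  2 ^ (6 + ⌈ x /2⌉) * 3 ^ (12 + x)                ∎
  where open ≤-Reasoning

2^q*4^[12q+e]≤2^⌈[12q+e]/2⌉*3^[12q+e] : ∀ q e →
  2 ^ q * 4 ^ (q * 12 + e) ≤ 2 ^ ⌈ q * 12 + e /2⌉ * 3 ^ (q * 12 + e)
2^q*4^[12q+e]≤2^⌈[12q+e]/2⌉*3^[12q+e] zero    e = ≤-trans (≤-reflexive (*-identityˡ (4 ^ e))) (4^e≤2^⌈e/2⌉*3^e e)
2^q*4^[12q+e]≤2^⌈[12q+e]/2⌉*3^[12q+e] (suc q) e =
  2^q*4^x≤⇒2^[1+q]*4^[12+x]≤ q (q * 12 + e) (2^q*4^[12q+e]≤2^⌈[12q+e]/2⌉*3^[12q+e] q e)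

2^[d/12]*4^d≤2^⌈d/2⌉*3^d : ∀ d → 2 ^ (d / 12) * 4 ^ d ≤ 2 ^ ⌈ d /2⌉ * 3 ^ d
2^[d/12]*4^d≤2^⌈d/2⌉*3^d d =
  subst (λ m → 2 ^ (d / 12) * 4 ^ m ≤ 2 ^ ⌈ m /2⌉ * 3 ^ m) (sym d≡[d/12]*12+d%12)
        (2^q*4^[12q+e]≤2^⌈[12q+e]/2⌉*3^[12q+e] (d / 12) (d % 12))
  where
  d≡[d/12]*12+d%12 : d ≡ d / 12 * 12 + d % 12
  d≡[d/12]*12+d%12 = trans (m≡m%n+[m/n]*n d 12) (+-comm (d % 12) _)

𝟙[d<2s]*2^⌈d/2⌉≤2^s : ∀ d s (2s≤d? : Dec (2 * s ≤ d)) → 𝟙 (not ⌊ 2s≤d? ⌋) * 2 ^ ⌈ d /2⌉ ≤ 2 ^ s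
𝟙[d<2s]*2^⌈d/2⌉≤2^s d s (yes _)   = z≤n
𝟙[d<2s]*2^⌈d/2⌉≤2^s d s (no 2s≰d) =
  ≤-trans (≤-reflexive (*-identityˡ (2 ^ ⌈ d /2⌉))) (^-monoʳ-≤ 2 {⌈ d /2⌉} {s} (n<2*m⇒⌈n/2⌉≤m (≰⇒> 2s≰d)))

module _ {n} (T : Tournament n) (v : Fin n) where

  private
    d = outdeg T v
    S = ∑ᶜ n (λ c → 𝟙 (bad T c v))

  ∑ᶜ-bad*2^⌈d/2⌉≤∑ᶜ-2^sameOut : S * 2 ^ ⌈ d /2⌉ ≤ ∑ᶜ n (λ c → 2 ^ sameOut T c v)
  ∑ᶜ-bad*2^⌈d/2⌉≤∑ᶜ-2^sameOut = begin
    S * 2 ^ ⌈ d /2⌉                               ≡⟨ *-comm S _ ⟩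
    2 ^ ⌈ d /2⌉ * S                               ≡⟨ *-distribˡ-∑ᶜ n (2 ^ ⌈ d /2⌉) _ ⟩
    ∑ᶜ n (λ c → 2 ^ ⌈ d /2⌉ * 𝟙 (bad T c v))      ≤⟨ ∑ᶜ-mono-≤ n Markov ⟩
    ∑ᶜ n (λ c → 2 ^ sameOut T c v)                ∎
    where
    open ≤-Reasoning
    Markov : ∀ c → 2 ^ ⌈ d /2⌉ * 𝟙 (bad T c v) ≤ 2 ^ sameOut T c v
    Markov c = ≤-trans (≤-reflexive (*-comm (2 ^ ⌈ d /2⌉) (𝟙 (bad T c v))))
                       (𝟙[d<2s]*2^⌈d/2⌉≤2^s d (sameOut T c v) (2 * sameOut T c v ≤? d))

  ∑ᶜ-bad*2^[d/12]≤3^n : S * 2 ^ (d / 12) ≤ 3 ^ n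
  ∑ᶜ-bad*2^[d/12]≤3^n = *-cancelʳ-≤ _ _ (4 ^ d) {{m^n≢0 4 d}} (begin
    S * 2 ^ (d / 12) * 4 ^ d                      ≡⟨ *-assoc S _ _ ⟩
    S * (2 ^ (d / 12) * 4 ^ d)                    ≤⟨ *-monoʳ-≤ S (2^[d/12]*4^d≤2^⌈d/2⌉*3^d d) ⟩
    S * (2 ^ ⌈ d /2⌉ * 3 ^ d)                     ≡⟨ *-assoc S _ _ ⟨
    S * 2 ^ ⌈ d /2⌉ * 3 ^ d                       ≤⟨ *-monoˡ-≤ (3 ^ d) ∑ᶜ-bad*2^⌈d/2⌉≤∑ᶜ-2^sameOut ⟩
    ∑ᶜ n (λ c → 2 ^ sameOut T c v) * 3 ^ d        ≡⟨ ∑ᶜ-2^hits-own-colour n (arc T v) v (irrefl T v) ⟩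
    3 ^ n * 4 ^ d                                 ∎)
    where open ≤-Reasoning

  ∑ᶜ-bad≤ : S ≤ 3 ^ n /2^ (2 * d / 24)
  ∑ᶜ-bad≤ = subst (λ q → S ≤ 3 ^ n /2^ q) (sym (m*n/m*o≡n/o 2 d 12)) (m*2^q≤n⇒m≤n/2^q (d / 12) ∑ᶜ-bad*2^[d/12]≤3^n)

∑ᶜ-count-bad≤48*3^n : ∀ {n} (T : Tournament n) → ∑ᶜ n (λ c → count (bad T c)) ≤ 48 * 3 ^ n
∑ᶜ-count-bad≤48*3^n {n} T = begin
  ∑ᶜ n (λ c → count (bad T c))                       ≡⟨ ∑ᶜ-cong n (λ c → count≡∑ (bad T c)) ⟩
  ∑ᶜ n (λ c → ∑[ v < n ] 𝟙 (bad T c v))              ≡⟨ ∑ᶜ-comm n (λ c v → 𝟙 (bad T c v)) ⟩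
  ∑[ v < n ] ∑ᶜ n (λ c → 𝟙 (bad T c v))              ≤⟨ ∑-mono-≤ {n} (∑ᶜ-bad≤ T) ⟩
  ∑[ v < n ] f (2 * outdeg T v)                      ≤⟨ ∑-antitone[2*outdeg]≤ T f f-antitone ⟩
  ∑[ i < n ] f (toℕ i)                               ≤⟨ ∑-m/2^[i/b]≤2*b*m 24 (3 ^ n) n ⟩
  2 * (24 * 3 ^ n)                                   ≡⟨ *-assoc 2 24 (3 ^ n) ⟨
  48 * 3 ^ n                                         ∎
  where
  open ≤-Reasoning
  f : ℕ → ℕ
  f i = 3 ^ n /2^ (i / 24)
  f-antitone : f Preserves _≤_ ⟶ _≥_
  f-antitone i≤j = /2^-antitone (3 ^ n) (/-monoˡ-≤ 24 i≤j)

theorem2 : ∀ (n : ℕ) (T : Tournament n) →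
    ∃ λ (c : Fin n → Fin 3) → count (bad T c) ≤ 205
theorem2 n T with ∃-≤-∑ᶜ-mean n (λ c → count (bad T c))
... | c , below-mean = c , *-cancelʳ-≤ (count (bad T c)) 205 (3 ^ n) {{m^n≢0 3 n}} (begin
  count (bad T c) * 3 ^ n                ≤⟨ below-mean ⟩
  ∑ᶜ n (λ c → count (bad T c))           ≤⟨ ∑ᶜ-count-bad≤48*3^n T ⟩
  48 * 3 ^ n                             ≤⟨ *-monoˡ-≤ (3 ^ n) (m≤m+n 48 157) ⟩
  205 * 3 ^ n                            ∎)
  where open ≤-Reasoning
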